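{- If a c.e. set $A$ is Type 7, then there is a Type 7 generating collection $\{D_0,R_0,R_1,\dots\}$ for $\mathcal{D}(A)$ such that (1) for every $j\in\omega$ the set $R_j-D_0$ is infinite (hence $\overline{A}-D_0$ is infinite), and (2) $D_0\subseteq\bigsqcup_{i\in\omega}R_i=\overline{A}$.
   Context: All sets are c.e. subsets of $\omega$. $X\subseteq^*Y$ means $X-Y$ finite. A collection $\mathcal{G}$ of c.e. sets generates $\mathcal{D}(A)$ if every member is disjoint from $A$ and every c.e. set disjoint from $A$ is $\subseteq^*$ a finite union of members. Types of generating collections: Type 1: $\{\emptyset\}$. Type 2: $\{R\}$, $R$ infinite computable. Type 3: $\{W\}$, $W$ infinite noncomputable. Type 4: $\{R_0,R_1,\dots\}$ infinite pairwise disjoint computable. Type 5: $\{D_0,R_0,R_1,\dots\}$ all infinite pairwise disjoint, $D_0$ the only noncomputable one. Type 6: $\{D_0,D_1,\dots\}$ infinite pairwise disjoint noncomputable. Type 7: $\{D_0,R_0,R_1,\dots\}$, $D_0$ the only noncomputable set, $R_i$ infinite pairwise disjoint computable, $D_0\cap R_i\neq\emptyset$ for infinitely many $i$. $A$ is Type 7 if $\mathcal{D}(A)$ has a Type 7 generating collection but none of Types 1–6. -}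

module Defs where

open import Level using (0ℓ)
open import Data.Nat using (ℕ; zero; suc; _<_)
open import Data.Fin using (Fin)
open import Data.Vec using (Vec; []; _∷_; lookup)
open import Data.Maybe using (Maybe; nothing; just)
open import Data.Unit using (⊤; tt)
open import Data.Empty using (⊥)
open import Data.List using (List)
open import Data.List.Relation.Unary.Any using (Any)
open import Data.Product using (Σ; ∃; _×_; _,_)
open import Relation.Nullary using (¬_)
open import Relation.Binary.PropositionalEquality using (_≡_; _≢_)

data PR : ℕ → Set where
  zeroF : ∀ {n} → PR n
  succF : PR 1
  projF : ∀ {n} → Fin n → PR n
  compF : ∀ {m n} → PR m → Vec (PR n) m → PR n
  primF : ∀ {n} → PR n → PR (suc (suc n)) → PR (suc n)
  muF   : ∀ {n} → PR (suc n) → PR n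

-- Big-step semantics: Eval f xs y  means  f(xs)↓ = y.
-- primF g h : f(0, xs) = g(xs), f(k+1, xs) = h(k, f(k,xs), xs)
-- muF f     : (μ y) f(y, xs) = 0, all f(z, xs) for z < y defined and nonzero.
mutual
  data Eval : ∀ {n} → PR n → Vec ℕ n → ℕ → Set where
    eZero : ∀ {n} {xs : Vec ℕ n} → Eval zeroF xs 0
    eSucc : ∀ {x} → Eval succF (x ∷ []) (suc x)
    eProj : ∀ {n} {i : Fin n} {xs} → Eval (projF i) xs (lookup xs i)
    eComp : ∀ {m n} {f : PR m} {gs : Vec (PR n) m} {xs ys y} →
            EvalAll gs xs ys → Eval f ys y → Eval (compF f gs) xs y
    ePrim0 : ∀ {n} {g : PR n} {h} {xs y} →
             Eval g xs y → Eval (primF g h) (0 ∷ xs) y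
    ePrimS : ∀ {n} {g : PR n} {h} {xs k r y} →
             Eval (primF g h) (k ∷ xs) r → Eval h (k ∷ r ∷ xs) y →
             Eval (primF g h) (suc k ∷ xs) y
    eMu   : ∀ {n} {f : PR (suc n)} {xs y} →
            Eval f (y ∷ xs) 0 →
            (∀ z → z < y → Σ ℕ λ v → Eval f (z ∷ xs) (suc v)) →
            Eval (muF f) xs y

  data EvalAll {n} : ∀ {m} → Vec (PR n) m → Vec ℕ n → Vec ℕ m → Set where
    [] : ∀ {xs} → EvalAll [] xs []
    _∷_ : ∀ {m} {g} {gs : Vec (PR n) m} {xs y ys} →
          Eval g xs y → EvalAll gs xs ys → EvalAll (g ∷ gs) xs (y ∷ ys)

SetN : Set₁
SetN = ℕ → Set

CE : SetN → Set
CE X = Σ (PR 1) λ f → ∀ n → (X n → ∃ λ y → Eval f (n ∷ []) y)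
                          × ((∃ λ y → Eval f (n ∷ []) y) → X n)

Computable : SetN → Set
Computable X = Σ (PR 1) λ f → ∀ n → (X n → Eval f (n ∷ []) 1)
                                  × (¬ X n → Eval f (n ∷ []) 0)

Finite : SetN → Set
Finite X = Σ ℕ λ b → ∀ n → X n → n < b

Infinite : SetN → Set
Infinite X = ¬ Finite X

_∖_ : SetN → SetN → SetN
(X ∖ Y) n = X n × ¬ Y n

_⊆*_ : SetN → SetN → Set
X ⊆* Y = Finite (X ∖ Y)

Disjoint : SetN → SetN → Set
Disjoint X Y = ∀ n → X n → Y n → ⊥

∅ : SetN
∅ _ = ⊥

PairwiseDisjoint : (ℕ → SetN) → Set
PairwiseDisjoint R = ∀ i j → i ≢ j → Disjoint (R i) (R j)

-- Generating collections of D(A).  A collection is given as an indexed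
-- family F : I → SetN (its members are the F i).

Generates : SetN → (I : Set) → (I → SetN) → Set₁
Generates A I F =
  (∀ i → CE (F i) × Disjoint (F i) A)
  × (∀ (X : SetN) → CE X → Disjoint X A →
       Σ (List I) λ L → X ⊆* (λ n → Any (λ i → F i n) L))

-- the collection {D₀, R₀, R₁, …}
withD : SetN → (ℕ → SetN) → Maybe ℕ → SetN
withD D R nothing  = D
withD D R (just i) = R i

HasType1 : SetN → Set₁
HasType1 A = Generates A ⊤ (λ _ → ∅)

HasType2 : SetN → Set₁
HasType2 A = Σ SetN λ R → Infinite R × Computable R × Generates A ⊤ (λ _ → R)

HasType3 : SetN → Set₁
HasType3 A = Σ SetN λ W → Infinite W × ¬ Computable W × Generates A ⊤ (λ _ → W)

HasType4 : SetN → Set₁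
HasType4 A = Σ (ℕ → SetN) λ R →
  (∀ i → Infinite (R i) × Computable (R i)) × PairwiseDisjoint R
  × Generates A ℕ R

HasType5 : SetN → Set₁
HasType5 A = Σ SetN λ D → Σ (ℕ → SetN) λ R →
  Infinite D × ¬ Computable D
  × (∀ i → Infinite (R i) × Computable (R i)) × PairwiseDisjoint R
  × (∀ i → Disjoint D (R i))
  × Generates A (Maybe ℕ) (withD D R)

HasType6 : SetN → Set₁
HasType6 A = Σ (ℕ → SetN) λ D →
  (∀ i → Infinite (D i) × ¬ Computable (D i)) × PairwiseDisjoint D
  × Generates A ℕ D

Type7Gen : SetN → SetN → (ℕ → SetN) → Set₁
Type7Gen A D R =
  ¬ Computable D
  × (∀ i → Infinite (R i) × Computable (R i)) × PairwiseDisjoint R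
  × Infinite (λ i → ∃ λ n → D n × R i n)
  × Generates A (Maybe ℕ) (withD D R)

HasType7 : SetN → Set₁
HasType7 A = Σ SetN λ D → Σ (ℕ → SetN) λ R → Type7Gen A D R

IsType7 : SetN → Set₁
IsType7 A = HasType7 A × ¬ HasType1 A × ¬ HasType2 A × ¬ HasType3 A
            × ¬ HasType4 A × ¬ HasType5 A × ¬ HasType6 A

module Submission where

-- Let {D, R₀, R₁, …} be any Type 7 generating collection for
-- D(A) and call R i large when R i ∖ D is infinite.
--   * If only finitely many R i are large, say all large ones have i < b, then
--     every member of the collection is ⊆* W = D ∪ R₀ ∪ … ∪ R_(b-1), so the
--     single c.e. set W generates D(A) and A has Type 1, 2 or 3: impossible.
--   * Hence the large indices can be enumerated as t₀ < t₁ < … .  Cut ω into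
--     consecutive blocks [lo k, t k], and let R'_k be the union of the R i in
--     block k, together with the point k if k lies in the complement of A but in
--     no R i.  The R'_k are computable and pairwise disjoint, R'_k ∖ D ⊇ R_(t k) ∖ D
--     is infinite, {D, R'₀, R'₁, …} still generates D(A), and the R'_k cover
--     the complement of A exactly.

open import Defs
open import Level using (0ℓ)
open import Axiom.ExcludedMiddle using (ExcludedMiddle)
open import Data.Nat using (ℕ; zero; suc; _<_; _≤_; z≤n; s≤s; _⊔_; _<?_; _≤?_; _≟_)
open import Data.Nat.Properties
  using (<-cmp; ≤-refl; ≤-trans; <-≤-trans; <⇒≤; <⇒≱; ≮⇒≥; m≤n⇒m≤1+n;
         m≤n⇒m<n∨m≡n; m<1+n⇒m<n∨m≡n; m≤m⊔n; m≤n⊔m)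
open import Data.Fin using () renaming (zero to fz; suc to fs)
open import Data.Vec using (Vec; []; _∷_)
open import Data.Unit using (⊤; tt)
open import Data.Maybe using (Maybe; nothing; just)
open import Data.List using (List; []; _∷_; map)
open import Data.List.Relation.Unary.Any using (Any; here; there)
open import Data.Product using (Σ; ∃; _×_; _,_; proj₁; proj₂)
open import Data.Sum using (_⊎_; inj₁; inj₂)
open import Data.Empty using (⊥; ⊥-elim)
open import Relation.Nullary using (¬_; yes; no)
open import Relation.Binary using (tri<; tri≈; tri>)
open import Relation.Binary.PropositionalEquality using (_≡_; refl; sym; trans; cong; _≢_)

zero≢suc : ∀ {v} {B : Set} → 0 ≡ suc v → B
zero≢suc ()

mutual
  eval-deterministic : ∀ {n} {f : PR n} {xs y y′} → Eval f xs y → Eval f xs y′ → y ≡ y′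
  eval-deterministic eZero eZero = refl
  eval-deterministic eSucc eSucc = refl
  eval-deterministic eProj eProj = refl
  eval-deterministic (eComp es e) (eComp es′ e′) with evalAll-deterministic es es′
  ... | refl = eval-deterministic e e′
  eval-deterministic (ePrim0 e) (ePrim0 e′) = eval-deterministic e e′
  eval-deterministic (ePrimS e₁ e₂) (ePrimS e₁′ e₂′) with eval-deterministic e₁ e₁′
  ... | refl = eval-deterministic e₂ e₂′
  eval-deterministic (eMu {y = y} e below) (eMu {y = y′} e′ below′) with <-cmp y y′
  ... | tri< y<y′ _ _ = zero≢suc (eval-deterministic e (proj₂ (below′ y y<y′)))
  ... | tri≈ _ y≡y′ _ = y≡y′
  ... | tri> _ _ y′<y = zero≢suc (eval-deterministic e′ (proj₂ (below y′ y′<y)))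

  evalAll-deterministic : ∀ {n m} {gs : Vec (PR n) m} {xs ys ys′} →
    EvalAll gs xs ys → EvalAll gs xs ys′ → ys ≡ ys′
  evalAll-deterministic [] [] = refl
  evalAll-deterministic (e ∷ es) (e′ ∷ es′)
    with eval-deterministic e e′ | evalAll-deterministic es es′
  ... | refl | refl = refl

one : ∀ {n} → PR n
one = compF succF (zeroF ∷ [])

one-eval : ∀ {n} {xs : Vec ℕ n} → Eval one xs 1
one-eval = eComp (eZero ∷ []) eSucc

notF : PR 1
notF = primF one zeroF

not-zero : Eval notF (0 ∷ []) 1
not-zero = ePrim0 one-eval

not-suc : ∀ k → Eval notF (suc k ∷ []) 0
not-suc zero    = ePrimS not-zero eZero
not-suc (suc k) = ePrimS (not-suc k) eZero

orF : PR 2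
orF = primF (projF fz) one

or-zero : ∀ b → Eval orF (0 ∷ b ∷ []) b
or-zero b = ePrim0 eProj

or-one : ∀ b → Eval orF (1 ∷ b ∷ []) 1
or-one b = ePrimS (or-zero b) one-eval

eqF : ℕ → PR 1
eqF zero    = notF
eqF (suc k) = primF zeroF (compF (eqF k) (projF fz ∷ []))

eq-total : ∀ k m → ∃ λ r → Eval (eqF k) (m ∷ []) r
eq-total zero zero          = 1 , not-zero
eq-total zero (suc m)       = 0 , not-suc m
eq-total (suc k) zero       = 0 , ePrim0 eZero
eq-total (suc k) (suc m)    = proj₁ (eq-total k m) ,
  ePrimS (proj₂ (eq-total (suc k) m)) (eComp (eProj ∷ []) (proj₂ (eq-total k m)))

eq-yes : ∀ k → Eval (eqF k) (k ∷ []) 1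
eq-yes zero    = not-zero
eq-yes (suc k) = ePrimS (proj₂ (eq-total (suc k) k)) (eComp (eProj ∷ []) (eq-yes k))

eq-no : ∀ k m → m ≢ k → Eval (eqF k) (m ∷ []) 0
eq-no zero zero m≢k       = ⊥-elim (m≢k refl)
eq-no zero (suc m) _      = not-suc m
eq-no (suc k) zero _      = ePrim0 eZero
eq-no (suc k) (suc m) m≢k = ePrimS (proj₂ (eq-total (suc k) m))
  (eComp (eProj ∷ []) (eq-no k m (λ m≡k → m≢k (cong suc m≡k))))

_∪_ : SetN → SetN → SetN
(X ∪ Y) n = X n ⊎ Y n

Union : {I : Set} → (I → SetN) → List I → SetN
Union F L n = Any (λ i → F i n) L

_⊆_ : SetN → SetN → Set
X ⊆ Y = ∀ n → X n → Y n

⊆⇒⊆* : {X Y : SetN} → X ⊆ Y → X ⊆* Y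
⊆⇒⊆* X⊆Y = 0 , λ n (x , ¬y) → ⊥-elim (¬y (X⊆Y n x))

finite⇒⊆* : {X Y : SetN} → Finite X → X ⊆* Y
finite⇒⊆* (b , bound) = b , λ n (x , _) → bound n x

infinite-mono : {X Y : SetN} → X ⊆ Y → Infinite X → Infinite Y
infinite-mono X⊆Y infX (b , bound) = infX (b , λ n x → bound n (X⊆Y n x))

union-⊆* : {I J : Set} {F : I → SetN} {G : J → SetN} (m : I → J) →
  (∀ i → F i ⊆* G (m i)) → ∀ L → Union F L ⊆* Union G (map m L)
union-⊆* m F⊆*G []      = 0 , λ { _ (() , _) }
union-⊆* {F = F} {G} m F⊆*G (i ∷ L) with F⊆*G i | union-⊆* m F⊆*G L
... | (b₁ , bound₁) | (b₂ , bound₂) = b₁ ⊔ b₂ , bound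
  where
  bound : ∀ n → (Union F (i ∷ L) ∖ Union G (map m (i ∷ L))) n → n < b₁ ⊔ b₂
  bound n (here x  , ¬y) = <-≤-trans (bound₁ n (x , λ y → ¬y (here y))) (m≤m⊔n b₁ b₂)
  bound n (there x , ¬y) = <-≤-trans (bound₂ n (x , λ y → ¬y (there y))) (m≤n⊔m b₁ b₂)

-- ω is cut into consecutive blocks [lo k, t k] along a strictly increasing t;
-- block i is the index of the block containing i.
module Blocks (t : ℕ → ℕ) (t-step : ∀ k → t k < t (suc k)) where

  t-mono : ∀ {k k′} → k ≤ k′ → t k ≤ t k′
  t-mono k≤k′ with m≤n⇒m<n∨m≡n k≤k′
  ... | inj₂ refl        = ≤-refl
  ... | inj₁ (s≤s k≤k″) = ≤-trans (t-mono k≤k″) (<⇒≤ (t-step _))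

  lo : ℕ → ℕ
  lo zero    = 0
  lo (suc k) = suc (t k)

  lo≤t : ∀ k → lo k ≤ t k
  lo≤t zero    = z≤n
  lo≤t (suc k) = t-step k

  InBlock : ℕ → ℕ → Set
  InBlock k i = lo k ≤ i × i < suc (t k)

  block : ℕ → ℕ
  block zero = 0
  block (suc i) with suc i <? suc (t (block i))
  ... | yes _ = block i
  ... | no _  = suc (block i)

  block-spec : ∀ i → InBlock (block i) i
  block-spec zero = z≤n , s≤s z≤n
  block-spec (suc i) with suc i <? suc (t (block i))
  ... | yes i<hi = m≤n⇒m≤1+n (proj₁ (block-spec i)) , i<hi
  ... | no  i≮hi = ≮⇒≥ i≮hi , s≤s (≤-trans (proj₂ (block-spec i)) (t-step (block i)))

  block-below : ∀ {k k′} → k < k′ → suc (t k) ≤ lo k′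
  block-below (s≤s k≤k′) = s≤s (t-mono k≤k′)

  block-unique : ∀ {k k′ i} → InBlock k i → InBlock k′ i → k ≡ k′
  block-unique {k} {k′} (lo≤i , i<hi) (lo′≤i , i<hi′) with <-cmp k k′
  ... | tri< k<k′ _ _ = ⊥-elim (<⇒≱ i<hi (≤-trans (block-below k<k′) lo′≤i))
  ... | tri≈ _ k≡k′ _ = k≡k′
  ... | tri> _ _ k′<k = ⊥-elim (<⇒≱ i<hi′ (≤-trans (block-below k′<k) lo≤i))

module Classical (lem : ExcludedMiddle 0ℓ) where

  computable-resp : {X Y : SetN} → X ⊆ Y → Y ⊆ X → Computable X → Computable Y
  computable-resp X⊆Y Y⊆X (f , spec) =
    f , λ n → (λ y → proj₁ (spec n) (Y⊆X n y)) , (λ ¬y → proj₂ (spec n) (λ x → ¬y (X⊆Y n x)))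

  computable-∅ : Computable ∅
  computable-∅ = zeroF , λ n → (λ ()) , (λ _ → eZero)

  computable-singleton : ∀ k → Computable (λ n → n ≡ k)
  computable-singleton k = eqF k , λ n → (λ { refl → eq-yes k }) , eq-no k n

  computable-∪ : {X Y : SetN} → Computable X → Computable Y → Computable (X ∪ Y)
  computable-∪ {X} {Y} (f , sf) (g , sg) = h , λ n → in-union n , not-in-union n
    where
    h : PR 1
    h = compF orF (f ∷ g ∷ [])
    in-X : ∀ n → X n → Eval h (n ∷ []) 1
    in-X n x with lem {Y n}
    ... | yes y = eComp (proj₁ (sf n) x ∷ proj₁ (sg n) y ∷ []) (or-one 1)
    ... | no ¬y = eComp (proj₁ (sf n) x ∷ proj₂ (sg n) ¬y ∷ []) (or-one 0)
    in-union : ∀ n → (X ∪ Y) n → Eval h (n ∷ []) 1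
    in-union n (inj₁ x) = in-X n x
    in-union n (inj₂ y) with lem {X n}
    ... | yes x = in-X n x
    ... | no ¬x = eComp (proj₂ (sf n) ¬x ∷ proj₁ (sg n) y ∷ []) (or-zero 1)
    not-in-union : ∀ n → ¬ (X ∪ Y) n → Eval h (n ∷ []) 0
    not-in-union n ¬xy =
      eComp (proj₂ (sf n) (λ x → ¬xy (inj₁ x)) ∷ proj₂ (sg n) (λ y → ¬xy (inj₂ y)) ∷ []) (or-zero 0)

  -- A computable set is the domain of the search (μ y) notF (χ n) = 0.
  computable⇒ce : {X : SetN} → Computable X → CE X
  computable⇒ce {X} (χ , spec) = muF g , λ n → halts n , sound n
    where
    g : PR 2
    g = compF notF (compF χ (projF (fs fz) ∷ []) ∷ [])
    halts : ∀ n → X n → ∃ λ y → Eval (muF g) (n ∷ []) y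
    halts n x = 0 , eMu (eComp (eComp (eProj ∷ []) (proj₁ (spec n) x) ∷ []) (not-suc 0)) (λ _ ())
    sound : ∀ n → (∃ λ y → Eval (muF g) (n ∷ []) y) → X n
    sound n (_ , eMu (eComp (eComp (eProj ∷ []) eχ ∷ []) enot) _) with lem {X n}
    ... | yes x = x
    ... | no ¬x with eval-deterministic eχ (proj₂ (spec n) ¬x)
    ...   | refl = zero≢suc (eval-deterministic enot not-zero)

  -- The union of a c.e. set X = dom f and a computable Y is the domain of
  -- n ↦ P (notF (χ n), n), where P (0, n) = 0 and P (1, n) = f n.
  ce-∪-computable : {X Y : SetN} → CE X → Computable Y → CE (X ∪ Y)
  ce-∪-computable {X} {Y} (f , sf) (χ , sχ) = p , λ n → halts n , sound n
    where
    P : PR 2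
    P = primF zeroF (compF f (projF (fs (fs fz)) ∷ []))
    p : PR 1
    p = compF P (compF notF (χ ∷ []) ∷ projF fz ∷ [])
    halts : ∀ n → (X ∪ Y) n → ∃ λ y → Eval p (n ∷ []) y
    halts n xy with lem {Y n} | xy
    ... | yes y | _      = 0 , eComp (eComp (proj₁ (sχ n) y ∷ []) (not-suc 0) ∷ eProj ∷ []) (ePrim0 eZero)
    ... | no ¬y | inj₂ y = ⊥-elim (¬y y)
    ... | no ¬y | inj₁ x with proj₁ (sf n) x
    ...   | (y , ef) = y , eComp (eComp (proj₂ (sχ n) ¬y ∷ []) not-zero ∷ eProj ∷ [])
                                 (ePrimS (ePrim0 eZero) (eComp (eProj ∷ []) ef))
    P-one : ∀ n y → Eval P (1 ∷ n ∷ []) y → X n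
    P-one n y (ePrimS _ (eComp (eProj ∷ []) ef)) = proj₂ (sf n) (y , ef)
    sound : ∀ n → (∃ λ y → Eval p (n ∷ []) y) → (X ∪ Y) n
    sound n (y , eComp (eComp (eχ ∷ []) enot ∷ eProj ∷ []) eP) with lem {Y n}
    ... | yes y′ = inj₂ y′
    ... | no ¬y with eval-deterministic eχ (proj₂ (sχ n) ¬y)
    ...   | refl with eval-deterministic enot not-zero
    ...     | refl = inj₁ (P-one n y eP)

  -- Almost inclusion is transitive: a point of X ∖ Z lies in X ∖ Y or in Y ∖ Z.
  ⊆*-trans : {X Y Z : SetN} → X ⊆* Y → Y ⊆* Z → X ⊆* Z
  ⊆*-trans {X} {Y} {Z} (b₁ , bound₁) (b₂ , bound₂) = b₁ ⊔ b₂ , bound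
    where
    bound : ∀ n → (X ∖ Z) n → n < b₁ ⊔ b₂
    bound n (x , ¬z) with lem {Y n}
    ... | yes y = <-≤-trans (bound₂ n (y , ¬z)) (m≤n⊔m b₁ b₂)
    ... | no ¬y = <-≤-trans (bound₁ n (x , ¬y)) (m≤m⊔n b₁ b₂)

  regroup : {A : SetN} {I J : Set} {F : I → SetN} {G : J → SetN} →
    Generates A I F → (∀ j → CE (G j) × Disjoint (G j) A) →
    (m : I → J) → (∀ i → F i ⊆* G (m i)) → Generates A J G
  regroup (_ , cover) members m F⊆*G = members , λ X ceX X#A →
    let (L , X⊆*F) = cover X ceX X#A
    in map m L , ⊆*-trans X⊆*F (union-⊆* m F⊆*G L)

  -- A single generator W makes A of Type 1, 2 or 3, according as W is finite,
  -- infinite computable, or infinite noncomputable.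
  single-generator : {A W : SetN} → Generates A ⊤ (λ _ → W) →
    HasType1 A ⊎ HasType2 A ⊎ HasType3 A
  single-generator {A} {W} gen with lem {Finite W}
  ... | yes finW = inj₁ (regroup gen (λ _ → computable⇒ce computable-∅ , λ _ ())
                                 (λ _ → tt) (λ _ → finite⇒⊆* finW))
  ... | no infW with lem {Computable W}
  ...   | yes compW = inj₂ (inj₁ (W , infW , compW , gen))
  ...   | no ¬compW = inj₂ (inj₂ (W , infW , ¬compW , gen))

  module Enumerate (P : ℕ → Set) (infP : Infinite P) where

    element-above : ∀ m → ∃ λ j → m ≤ j × P j
    element-above m with lem {∃ λ j → m ≤ j × P j}
    ... | yes found = found
    ... | no none   = ⊥-elim (infP (m , bound))
      where
      bound : ∀ n → P n → n < m
      bound n pn with n <? m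
      ... | yes n<m = n<m
      ... | no n≮m  = ⊥-elim (none (n , ≮⇒≥ n≮m , pn))

    t : ℕ → ℕ
    t zero    = proj₁ (element-above 0)
    t (suc k) = proj₁ (element-above (suc (t k)))

    t-in : ∀ k → P (t k)
    t-in zero    = proj₂ (proj₂ (element-above 0))
    t-in (suc k) = proj₂ (proj₂ (element-above (suc (t k))))

    t-step : ∀ k → t k < t (suc k)
    t-step k = proj₁ (proj₂ (element-above (suc (t k))))

  module FiniteUnions (R : ℕ → SetN) (computableR : ∀ i → Computable (R i)) where

    Span : ℕ → ℕ → SetN
    Span a b n = ∃ λ i → a ≤ i × i < b × R i n

    grow : ∀ {a b} → Span a b ⊆ Span a (suc b)
    grow n (i , a≤i , i<b , r) = i , a≤i , m≤n⇒m≤1+n i<b , r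

    computable-span : ∀ a b → Computable (Span a b)
    computable-span a zero = computable-resp (λ _ ()) (λ { _ (_ , _ , () , _) }) computable-∅
    computable-span a (suc b) with a ≤? b
    ... | yes a≤b = computable-resp add remove (computable-∪ (computableR b) (computable-span a b))
      where
      add : (R b ∪ Span a b) ⊆ Span a (suc b)
      add n (inj₁ r) = b , a≤b , ≤-refl , r
      add n (inj₂ s) = grow n s
      remove : Span a (suc b) ⊆ (R b ∪ Span a b)
      remove n (i , a≤i , i<1+b , r) with m<1+n⇒m<n∨m≡n i<1+b
      ... | inj₁ i<b  = inj₂ (i , a≤i , i<b , r)
      ... | inj₂ refl = inj₁ r
    ... | no a≰b = computable-resp grow remove (computable-span a b)
      where
      remove : Span a (suc b) ⊆ Span a b
      remove n (i , a≤i , i<1+b , r) with m<1+n⇒m<n∨m≡n i<1+b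
      ... | inj₁ i<b  = i , a≤i , i<b , r
      ... | inj₂ refl = ⊥-elim (a≰b a≤i)

  module Type7Collection (A D : SetN) (R : ℕ → SetN)
    (infinite-computableR : ∀ i → Infinite (R i) × Computable (R i))
    (disjointR : PairwiseDisjoint R)
    (D-meets : Infinite (λ i → ∃ λ n → D n × R i n))
    (gen : Generates A (Maybe ℕ) (withD D R)) where

    open FiniteUnions R (λ i → proj₂ (infinite-computableR i))

    D#A : Disjoint D A
    D#A = proj₂ (proj₁ gen nothing)

    R#A : ∀ i → Disjoint (R i) A
    R#A i = proj₂ (proj₁ gen (just i))

    Large : ℕ → Set
    Large i = Infinite (R i ∖ D)

    few-large : ∀ b → (∀ i → Large i → i < b) → Generates A ⊤ (λ _ → D ∪ Span 0 b)
    few-large b bound = regroup gen (λ _ → ce-W , W#A) (λ _ → tt) member⊆*W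
      where
      ce-W : CE (D ∪ Span 0 b)
      ce-W = ce-∪-computable (proj₁ (proj₁ gen nothing)) (computable-span 0 b)
      W#A : Disjoint (D ∪ Span 0 b) A
      W#A n (inj₁ d) = D#A n d
      W#A n (inj₂ (i , _ , _ , r)) = R#A i n r
      member⊆*W : ∀ g → withD D R g ⊆* (D ∪ Span 0 b)
      member⊆*W nothing = ⊆⇒⊆* (λ n → inj₁)
      member⊆*W (just i) with i <? b
      ... | yes i<b = ⊆⇒⊆* (λ n r → inj₂ (i , z≤n , i<b , r))
      ... | no i≮b with lem {Finite (R i ∖ D)}
      ...   | yes R∖D-finite = ⊆*-trans R∖D-finite (⊆⇒⊆* (λ n → inj₁))
      ...   | no  R∖D-infinite = ⊥-elim (i≮b (bound i R∖D-infinite))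

    many-large : ¬ HasType1 A → ¬ HasType2 A → ¬ HasType3 A → Infinite Large
    many-large ¬T1 ¬T2 ¬T3 (b , bound) with single-generator (few-large b bound)
    ... | inj₁ t1        = ¬T1 t1
    ... | inj₂ (inj₁ t2) = ¬T2 t2
    ... | inj₂ (inj₂ t3) = ¬T3 t3

    -- Given infinitely many large R i, group the R i into blocks each ending in one.
    module Coarsen (large-infinite : Infinite Large) where

      open Enumerate Large large-infinite
      open Blocks t t-step

      Uncovered : SetN
      Uncovered n = ¬ A n × (∀ i → ¬ R i n)

      R′ : ℕ → SetN
      R′ k n = Span (lo k) (suc (t k)) n ⊎ (n ≡ k × Uncovered n)

      R⊆R′ : ∀ i → R i ⊆ R′ (block i)
      R⊆R′ i n r = inj₁ (i , proj₁ (block-spec i) , proj₂ (block-spec i) , r)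

      Rt⊆R′ : ∀ k → R (t k) ⊆ R′ k
      Rt⊆R′ k n r = inj₁ (t k , lo≤t k , ≤-refl , r)

      R′#A : ∀ k → Disjoint (R′ k) A
      R′#A k n (inj₁ (i , _ , _ , r)) = R#A i n r
      R′#A k n (inj₂ (_ , ¬a , _))     = ¬a

      computable-R′ : ∀ k → Computable (R′ k)
      computable-R′ k with lem {Uncovered k}
      ... | yes unc = computable-resp add remove
                        (computable-∪ (computable-span (lo k) (suc (t k))) (computable-singleton k))
        where
        add : (Span (lo k) (suc (t k)) ∪ (λ n → n ≡ k)) ⊆ R′ k
        add n (inj₁ s)    = inj₁ s
        add n (inj₂ refl) = inj₂ (refl , unc)
        remove : R′ k ⊆ (Span (lo k) (suc (t k)) ∪ (λ n → n ≡ k))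
        remove n (inj₁ s)       = inj₁ s
        remove n (inj₂ (n≡k , _)) = inj₂ n≡k
      ... | no ¬unc = computable-resp (λ n → inj₁) remove (computable-span (lo k) (suc (t k)))
        where
        remove : R′ k ⊆ Span (lo k) (suc (t k))
        remove n (inj₁ s)            = s
        remove n (inj₂ (refl , unc)) = ⊥-elim (¬unc unc)

      infinite-computable-R′ : ∀ k → Infinite (R′ k) × Computable (R′ k)
      infinite-computable-R′ k =
        infinite-mono (Rt⊆R′ k) (proj₁ (infinite-computableR (t k))) , computable-R′ k

      -- Distinct blocks involve distinct R i, and added points are their own index.
      disjoint-R′ : PairwiseDisjoint R′
      disjoint-R′ k k′ k≢k′ n (inj₁ (i , lo≤i , i<hi , r)) (inj₁ (i′ , lo′≤i′ , i′<hi′ , r′))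
        with i ≟ i′
      ... | yes refl = k≢k′ (block-unique (lo≤i , i<hi) (lo′≤i′ , i′<hi′))
      ... | no i≢i′  = disjointR i i′ i≢i′ n r r′
      disjoint-R′ k k′ _ n (inj₁ (i , _ , _ , r)) (inj₂ (_ , _ , ¬R)) = ¬R i r
      disjoint-R′ k k′ _ n (inj₂ (_ , _ , ¬R)) (inj₁ (i , _ , _ , r)) = ¬R i r
      disjoint-R′ k k′ k≢k′ n (inj₂ (n≡k , _)) (inj₂ (n≡k′ , _)) = k≢k′ (trans (sym n≡k) n≡k′)

      -- If D met only R′ k with k < b, it would meet only R i with i ≤ t b.
      D-meets-R′ : Infinite (λ k → ∃ λ n → D n × R′ k n)
      D-meets-R′ (b , bound) = D-meets (suc (t b) , bound′)
        where
        bound′ : ∀ i → (∃ λ n → D n × R i n) → i < suc (t b)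
        bound′ i (n , d , r) = <-≤-trans (proj₂ (block-spec i))
          (s≤s (t-mono (<⇒≤ (bound (block i) (n , d , R⊆R′ i n r)))))

      -- R′ k contains the large set R (t k).
      R′∖D-infinite : ∀ k → Infinite (R′ k ∖ D)
      R′∖D-infinite k = infinite-mono (λ n (r , ¬d) → Rt⊆R′ k n r , ¬d) (t-in k)

      -- {D, R′₀, …} generates D(A) since D ⊆ D and R i ⊆ R′ (block i).
      regroup-index : Maybe ℕ → Maybe ℕ
      regroup-index nothing  = nothing
      regroup-index (just i) = just (block i)

      generates-R′ : Generates A (Maybe ℕ) (withD D R′)
      generates-R′ = regroup gen members regroup-index member⊆
        where
        members : ∀ g → CE (withD D R′ g) × Disjoint (withD D R′ g) A
        members nothing  = proj₁ gen nothing
        members (just k) = computable⇒ce (computable-R′ k) , R′#A k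
        member⊆ : ∀ g → withD D R g ⊆* withD D R′ (regroup-index g)
        member⊆ nothing  = ⊆⇒⊆* (λ _ d → d)
        member⊆ (just i) = ⊆⇒⊆* (R⊆R′ i)

      R′-cover : ∀ n → ¬ A n → ∃ λ k → R′ k n
      R′-cover n ¬a with lem {∃ λ i → R i n}
      ... | yes (i , r) = block i , R⊆R′ i n r
      ... | no ¬covered = n , inj₂ (refl , ¬a , λ i r → ¬covered (i , r))

lemma3p23 : ExcludedMiddle 0ℓ → (A : SetN) → CE A → IsType7 A →
    Σ SetN λ D₀ → Σ (ℕ → SetN) λ R →
    Type7Gen A D₀ R
    × (∀ j → Infinite (R j ∖ D₀))
    × Infinite ((λ n → ¬ A n) ∖ D₀)
    × (∀ n → D₀ n → ∃ λ i → R i n)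
    × (∀ n → (¬ A n → ∃ λ i → R i n) × ((∃ λ i → R i n) → ¬ A n))
-- The coarsened collection {D, R′₀, R′₁, …}; the complement of A minus D is
-- infinite because it contains R′₀ ∖ D.
lemma3p23 lem A _ ((D , R , ¬compD , infcompR , disjR , D-meets , gen) , ¬T1 , ¬T2 , ¬T3 , _) =
  D , R′ ,
  (¬compD , infinite-computable-R′ ,
   disjoint-R′ , D-meets-R′ , generates-R′) ,
  R′∖D-infinite ,
  infinite-mono (λ n (r , ¬d) → R′#A 0 n r , ¬d) (R′∖D-infinite 0) ,
  (λ n d → R′-cover n (D#A n d)) ,
  (λ n → R′-cover n , λ (k , r) → R′#A k n r)
  where open Classical lem
        open Type7Collection A D R infcompR disjR D-meets gen
        open Coarsen (many-large ¬T1 ¬T2 ¬T3)
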